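{- For all $n\ge1$: \[\beta(L_{2n})=10^{2n}\cdot0^{2n-1}1,\qquad \gamma(L_{2n})=[10]^{n-1}11\cdot0^{2n-1}1,\] \[\beta(L_{2n+1})=\gamma(L_{2n+1})=1[01]^n\cdot[01]^n,\] \[\beta(L_{2n}+1)=\gamma(L_{2n}+1)=10^{2n-1}1\cdot0^{2n-1}1,\] \[\beta(L_{2n+1}+1)=\gamma(L_{2n+1}+1)=10^{2n+1}\cdot[10]^n01.\]
   Context: Let $\varphi=(1+\sqrt5)/2$. Lucas numbers: $L_0=2$, $L_1=1$, $L_n=L_{n-1}+L_{n-2}$ for $n\ge2$. A base-$\varphi$ representation $N=\sum_{i=R}^{L}a_i\varphi^i$ is written as the string $a_L\dots a_1a_0\cdot a_{ -1}\dots a_R$, where the point separates the digit of index $0$ from that of index $-1$. In strings, $0^k$ denotes $k$ zeros and $[w]^k$ denotes the word $w$ repeated $k$ times. The Bergman representation $\beta(N)$ is the unique finite expansion of $N$ with digits in $\{0,1\}$ and no two consecutive digits $11$. The canonical representation $\gamma(N)$: if $N$ has a finite representation with digits in $\{0,1\}$, $c_1=c_0=1$, and $c_{i+1}c_i\ne11$ for all $i\ne0$, then $\gamma(N)$ is this (unique) representation; otherwise $\gamma(N)=\beta(N)$. -}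

module Defs where

open import Data.Nat using (ℕ; zero; suc; _≤_)
open import Data.Integer as ℤ using (ℤ; +_)
open import Data.Product using (Σ; _×_; _,_)
open import Data.Sum using (_⊎_)
open import Data.Unit using (⊤)
open import Data.List using (List; []; _∷_; _++_; concat; replicate)
open import Data.List.Relation.Unary.All using (All)
open import Relation.Nullary using (¬_)
open import Relation.Binary.PropositionalEquality using (_≡_)

lucas : ℕ → ℕ
lucas zero = 2
lucas (suc zero) = 1
lucas (suc (suc n)) = lucas (suc n) + lucas n
  where open Data.Nat using (_+_)

-- ℤ[φ] : the pair (a , b) stands for the real number a + b·φ.
-- Since 1 and φ are linearly independent over ℚ, equality of pairs is
-- equality of the corresponding reals.
ℤφ : Set
ℤφ = ℤ × ℤ

-- multiplication by φ   : φ(a + bφ) = b + (a+b)φ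
mulφ : ℤφ → ℤφ
mulφ (a , b) = (b , a ℤ.+ b)

-- multiplication by φ⁻¹ = φ - 1 : (a + bφ)(φ - 1) = (b - a) + aφ
divφ : ℤφ → ℤφ
divφ (a , b) = (b ℤ.- a , a)

addDigit : ℕ → ℤφ → ℤφ
addDigit d (a , b) = (a ℤ.+ + d , b)

-- A finite base-φ representation  a_L … a_1 a_0 · a_{-1} … a_R :
-- int  = [a_L , … , a_0]     (most significant first)
-- frac = [a_{-1} , … , a_R]  (digit right after the point first)
record Rep : Set where
  constructor _·_
  field
    int  : List ℕ
    frac : List ℕ
open Rep public

valInt : List ℕ → ℤφ → ℤφ
valInt [] acc = acc
valInt (d ∷ ds) acc = valInt ds (addDigit d (mulφ acc))

valFrac : List ℕ → ℤφ
valFrac [] = (+ 0 , + 0)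
valFrac (d ∷ ds) = divφ (addDigit d (valFrac ds))

addℤφ : ℤφ → ℤφ → ℤφ
addℤφ (a , b) (c , d) = (a ℤ.+ c , b ℤ.+ d)

value : Rep → ℤφ
value r = addℤφ (valInt (int r) (+ 0 , + 0)) (valFrac (frac r))

embed : ℕ → ℤφ
embed N = (+ N , + 0)

No11 : List ℕ → Set
No11 [] = ⊤
No11 (x ∷ []) = ⊤
No11 (x ∷ y ∷ r) = ¬ (x ≡ 1 × y ≡ 1) × No11 (y ∷ r)

Digits01 : Rep → Set
Digits01 r = All (_≤ 1) (int r ++ frac r)

-- r is the Bergman representation β(N)
-- (β(N) is the unique such representation, up to leading/trailing zeros)
IsBergman : ℕ → Rep → Set
IsBergman N r = Digits01 r × No11 (int r ++ frac r) × value r ≡ embed N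

-- r is a representation with digits in {0,1}, c_1 = c_0 = 1 and
-- c_{i+1} c_i ≠ 11 for all i ≠ 0
IsCanonicalRep : ℕ → Rep → Set
IsCanonicalRep N r =
  Digits01 r ×
  Σ (List ℕ) (λ p → int r ≡ p ++ (1 ∷ 1 ∷ []) ×
                    No11 (p ++ (1 ∷ [])) × No11 (1 ∷ frac r)) ×
  value r ≡ embed N

-- r is γ(N): the canonical representation if it exists, else β(N)
IsGamma : ℕ → Rep → Set
IsGamma N r = IsCanonicalRep N r ⊎
              ((¬ Σ Rep (IsCanonicalRep N)) × IsBergman N r)

pow : ℕ → List ℕ → List ℕ
pow k w = concat (replicate k w)

zeros : ℕ → List ℕ
zeros k = replicate k 0

-- All values are computed in ℤ[φ] from Binet's formula L_k = φ^k + ψ^k, where ψ = 1 − φ = −φ⁻¹,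
-- so L_{2n} = φ^{2n} + φ^{-2n} and L_{2n+1} = φ^{2n+1} − φ^{-(2n+1)}; the strings [01]^n and
-- [10]^n evaluate to telescoping geometric sums. For γ: a canonical representation p11·f of N
-- yields the Bergman representation p10·f of N − 1, whose digit c_1 is 1. Hence if β(N − 1)
-- has c_1 = 0, then N has no canonical representation and γ(N) = β(N). Uniqueness of Bergman
-- representations follows from Zeckendorf's theorem via the additive map a + bφ ↦ a + 2b,
-- which sends φ^k to the Fibonacci number F_{k+2}.
module Submission where

open import Defs
open import Data.Nat using (ℕ; _≤_; _+_; _*_; _∸_)
open import Data.Product using (_×_)
open import Data.List using (List; []; _∷_; _++_)

open import Algebra.Bundles using (CommutativeSemigroup; AbelianGroup)
import Algebra.Properties.CommutativeSemigroup as CommutativeSemigroupProperties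
import Algebra.Properties.Group as GroupProperties
open import Data.Empty using (⊥-elim)
open import Data.Integer as ℤ using (ℤ; +_)
import Data.Integer.Properties as ℤP
open import Data.Integer.Tactic.RingSolver using (solve-∀)
open import Data.List using (length)
open import Data.List.Properties
  using (++-assoc; ++-identityʳ; length-++; length-replicate; ∷-injectiveˡ; ∷-injectiveʳ)
open import Data.List.Relation.Unary.All using (All; []; _∷_)
open import Data.List.Relation.Unary.All.Properties using (++⁺; ++⁻ˡ; ++⁻ʳ; concat⁺; replicate⁺)
open import Data.Nat using (zero; suc; z≤n; s≤s; _<_)
open import Data.Nat.GeneralisedArithmetic using (fold; fold-+)
import Data.Nat.Properties as ℕP
import Data.Nat.Tactic.RingSolver as ℕ-Solver
open import Data.Product using (Σ; _,_; proj₁; proj₂)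
open import Data.Sum using (inj₁; inj₂)
open import Data.Unit using (tt)
open import Function using (_∘_)
open import Level using (0ℓ)
open import Relation.Binary.PropositionalEquality
open import Relation.Binary.PropositionalEquality.Algebra using (isMagma)
open import Relation.Nullary using (¬_)
open ≡-Reasoning

-- Arithmetic in ℤ[φ]

infixl 6 _⊕_

_⊕_ : ℤφ → ℤφ → ℤφ
_⊕_ = addℤφ

0φ 1φ : ℤφ
0φ = embed 0
1φ = embed 1

⊕-assoc : ∀ x y z → (x ⊕ y) ⊕ z ≡ x ⊕ (y ⊕ z)
⊕-assoc (a , b) (c , d) (e , f) = cong₂ _,_ (ℤP.+-assoc a c e) (ℤP.+-assoc b d f)

⊕-comm : ∀ x y → x ⊕ y ≡ y ⊕ x
⊕-comm (a , b) (c , d) = cong₂ _,_ (ℤP.+-comm a c) (ℤP.+-comm b d)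

⊕-identityʳ : ∀ x → x ⊕ 0φ ≡ x
⊕-identityʳ (a , b) = cong₂ _,_ (ℤP.+-identityʳ a) (ℤP.+-identityʳ b)

⊕-cancelʳ : ∀ z {x y} → x ⊕ z ≡ y ⊕ z → x ≡ y
⊕-cancelʳ (c , d) {a , b} {a′ , b′} eq =
  cong₂ _,_ (+-cancelʳ c a a′ (cong proj₁ eq)) (+-cancelʳ d b b′ (cong proj₂ eq))
  where open GroupProperties (AbelianGroup.group ℤP.+-0-abelianGroup) renaming (∙-cancelʳ to +-cancelʳ)

⊕-commutativeSemigroup : CommutativeSemigroup 0ℓ 0ℓ
⊕-commutativeSemigroup = record
  { _≈_ = _≡_
  ; _∙_ = _⊕_
  ; isCommutativeSemigroup = record
    { isSemigroup = record { isMagma = isMagma _⊕_ ; assoc = ⊕-assoc }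
    ; comm = ⊕-comm
    }
  }

open CommutativeSemigroupProperties ⊕-commutativeSemigroup using (interchange; xy∙z≈xz∙y)

-- Multiplication by ψ = 1 − φ = −φ⁻¹, the conjugate of φ.
mulψ : ℤφ → ℤφ
mulψ (a , b) = (a ℤ.- b , ℤ.- a)

mulφ-⊕ : ∀ x y → mulφ (x ⊕ y) ≡ mulφ x ⊕ mulφ y
mulφ-⊕ (a , b) (c , d) = cong (b ℤ.+ d ,_) (ℤ-interchange a c b d)
  where open CommutativeSemigroupProperties ℤP.+-commutativeSemigroup renaming (interchange to ℤ-interchange)

divφ-⊕ : ∀ x y → divφ (x ⊕ y) ≡ divφ x ⊕ divφ y
divφ-⊕ (a , b) (c , d) = cong (_, a ℤ.+ c) (lemma a b c d)
  where
  lemma : ∀ a b c d → (b ℤ.+ d) ℤ.- (a ℤ.+ c) ≡ (b ℤ.- a) ℤ.+ (d ℤ.- c)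
  lemma = solve-∀

mulφ-divφ : ∀ x → mulφ (divφ x) ≡ x
mulφ-divφ (a , b) = cong (a ,_) (lemma a b)
  where
  lemma : ∀ a b → (b ℤ.- a) ℤ.+ a ≡ b
  lemma = solve-∀

mulφ² : ∀ x → mulφ (mulφ x) ≡ mulφ x ⊕ x
mulφ² (a , b) = cong₂ _,_ (ℤP.+-comm a b) (lemma a b)
  where
  lemma : ∀ a b → b ℤ.+ (a ℤ.+ b) ≡ (a ℤ.+ b) ℤ.+ b
  lemma = solve-∀

mulψ² : ∀ x → mulψ (mulψ x) ≡ mulψ x ⊕ x
mulψ² (a , b) = cong₂ _,_ (lemma₁ a b) (lemma₂ a b)
  where
  lemma₁ : ∀ a b → (a ℤ.- b) ℤ.- (ℤ.- a) ≡ (a ℤ.- b) ℤ.+ a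
  lemma₁ = solve-∀
  lemma₂ : ∀ a b → ℤ.- (a ℤ.- b) ≡ ℤ.- a ℤ.+ b
  lemma₂ = solve-∀

mulψ²≡divφ² : ∀ x → mulψ (mulψ x) ≡ divφ (divφ x)
mulψ²≡divφ² (a , b) = cong₂ _,_ (lemma₁ a b) (lemma₂ a b)
  where
  lemma₁ : ∀ a b → (a ℤ.- b) ℤ.- (ℤ.- a) ≡ a ℤ.- (b ℤ.- a)
  lemma₁ = solve-∀
  lemma₂ : ∀ a b → ℤ.- (a ℤ.- b) ≡ b ℤ.- a
  lemma₂ = solve-∀

mulψ-⊕-divφ : ∀ x → mulψ x ⊕ divφ x ≡ 0φ
mulψ-⊕-divφ (a , b) = cong₂ _,_ (lemma₁ a b) (ℤP.+-inverseˡ a)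
  where
  lemma₁ : ∀ a b → (a ℤ.- b) ℤ.+ (b ℤ.- a) ≡ + 0
  lemma₁ = solve-∀

addDigit-as-⊕ : ∀ d x → addDigit d x ≡ x ⊕ embed d
addDigit-as-⊕ d (a , b) = cong (a ℤ.+ + d ,_) (sym (ℤP.+-identityʳ b))

addDigit-0 : ∀ x → addDigit 0 x ≡ x
addDigit-0 x = trans (addDigit-as-⊕ 0 x) (⊕-identityʳ x)

addDigit-⊕ : ∀ d x y → addDigit d x ⊕ y ≡ addDigit d (x ⊕ y)
addDigit-⊕ d x y = begin
  addDigit d x ⊕ y     ≡⟨ cong (_⊕ y) (addDigit-as-⊕ d x) ⟩
  (x ⊕ embed d) ⊕ y    ≡⟨ xy∙z≈xz∙y x (embed d) y ⟩
  (x ⊕ y) ⊕ embed d    ≡⟨ sym (addDigit-as-⊕ d (x ⊕ y)) ⟩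
  addDigit d (x ⊕ y)   ∎

⊕-addDigit : ∀ d x y → x ⊕ addDigit d y ≡ addDigit d (x ⊕ y)
⊕-addDigit d x y = begin
  x ⊕ addDigit d y     ≡⟨ cong (x ⊕_) (addDigit-as-⊕ d y) ⟩
  x ⊕ (y ⊕ embed d)    ≡⟨ sym (⊕-assoc x y (embed d)) ⟩
  (x ⊕ y) ⊕ embed d    ≡⟨ sym (addDigit-as-⊕ d (x ⊕ y)) ⟩
  addDigit d (x ⊕ y)   ∎

-- Powers of φ, φ⁻¹ and ψ, and Binet's formula

mulφ^ : ℕ → ℤφ → ℤφ
mulφ^ k x = fold x mulφ k

φ^_ φ⁻^_ ψ^_ : ℕ → ℤφ
φ^ k = mulφ^ k 1φ
φ⁻^ k = fold 1φ divφ k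
ψ^ k = fold 1φ mulψ k

fold-init : ∀ {A : Set} (f : A → A) x k → fold (f x) f k ≡ f (fold x f k)
fold-init f x zero = refl
fold-init f x (suc k) = cong f (fold-init f x k)

mulφ^-comm : ∀ j k x → mulφ^ j (mulφ^ k x) ≡ mulφ^ k (mulφ^ j x)
mulφ^-comm j k x = begin
  fold (fold x mulφ k) mulφ j   ≡⟨ sym (fold-+ x mulφ j) ⟩
  fold x mulφ (j + k)           ≡⟨ cong (fold x mulφ) (ℕP.+-comm j k) ⟩
  fold x mulφ (k + j)           ≡⟨ fold-+ x mulφ k ⟩
  fold (fold x mulφ j) mulφ k   ∎

binet : ∀ k → embed (lucas k) ≡ φ^ k ⊕ ψ^ k
binet 0 = refl
binet 1 = refl
binet (suc (suc k)) = begin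
  embed (lucas (suc k)) ⊕ embed (lucas k)        ≡⟨ cong₂ _⊕_ (binet (suc k)) (binet k) ⟩
  (φ^ suc k ⊕ ψ^ suc k) ⊕ (φ^ k ⊕ ψ^ k)        ≡⟨ interchange (φ^ suc k) (ψ^ suc k) (φ^ k) (ψ^ k) ⟩
  (φ^ suc k ⊕ φ^ k) ⊕ (ψ^ suc k ⊕ ψ^ k)        ≡⟨ sym (cong₂ _⊕_ (mulφ² (φ^ k)) (mulψ² (ψ^ k))) ⟩
  φ^ suc (suc k) ⊕ ψ^ suc (suc k)                ∎

2*suc : ∀ n → 2 * suc n ≡ suc (suc (2 * n))
2*suc n = ℕP.*-suc 2 n

ψ^-even : ∀ n → ψ^ (2 * n) ≡ φ⁻^ (2 * n)
ψ^-even zero = refl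
ψ^-even (suc n) = begin
  ψ^ (2 * suc n)                   ≡⟨ cong ψ^_ (2*suc n) ⟩
  mulψ (mulψ (ψ^ (2 * n)))         ≡⟨ mulψ²≡divφ² (ψ^ (2 * n)) ⟩
  divφ (divφ (ψ^ (2 * n)))         ≡⟨ cong (divφ ∘ divφ) (ψ^-even n) ⟩
  divφ (divφ (φ⁻^ (2 * n)))        ≡⟨ cong φ⁻^_ (sym (2*suc n)) ⟩
  φ⁻^ (2 * suc n)                  ∎

lucas-even : ∀ n → embed (lucas (2 * n)) ≡ φ^ (2 * n) ⊕ φ⁻^ (2 * n)
lucas-even n = trans (binet (2 * n)) (cong (φ^ (2 * n) ⊕_) (ψ^-even n))

lucas-odd : ∀ n → embed (lucas (2 * n + 1)) ⊕ φ⁻^ (2 * n + 1) ≡ φ^ (2 * n + 1)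
lucas-odd n rewrite ℕP.+-comm (2 * n) 1 = begin
  embed (lucas k) ⊕ φ⁻^ k                              ≡⟨ cong (_⊕ φ⁻^ k) (binet k) ⟩
  (φ^ k ⊕ ψ^ k) ⊕ φ⁻^ k                                ≡⟨ ⊕-assoc (φ^ k) (ψ^ k) (φ⁻^ k) ⟩
  φ^ k ⊕ (mulψ (ψ^ (2 * n)) ⊕ divφ (φ⁻^ (2 * n)))      ≡⟨ cong (λ z → φ^ k ⊕ (mulψ z ⊕ divφ (φ⁻^ (2 * n)))) (ψ^-even n) ⟩
  φ^ k ⊕ (mulψ (φ⁻^ (2 * n)) ⊕ divφ (φ⁻^ (2 * n)))     ≡⟨ cong (φ^ k ⊕_) (mulψ-⊕-divφ (φ⁻^ (2 * n))) ⟩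
  φ^ k ⊕ 0φ                                            ≡⟨ ⊕-identityʳ (φ^ k) ⟩
  φ^ k                                                 ∎
  where k = suc (2 * n)

-- Evaluating digit strings

valInt-++ : ∀ xs ys a → valInt (xs ++ ys) a ≡ valInt ys (valInt xs a)
valInt-++ [] ys a = refl
valInt-++ (d ∷ xs) ys a = valInt-++ xs ys (addDigit d (mulφ a))

valInt-⊕ : ∀ ds a b → valInt ds (a ⊕ b) ≡ mulφ^ (length ds) a ⊕ valInt ds b
valInt-⊕ [] a b = refl
valInt-⊕ (d ∷ ds) a b = begin
  valInt ds (addDigit d (mulφ (a ⊕ b)))                ≡⟨ cong (valInt ds ∘ addDigit d) (mulφ-⊕ a b) ⟩
  valInt ds (addDigit d (mulφ a ⊕ mulφ b))             ≡⟨ cong (valInt ds) (sym (⊕-addDigit d (mulφ a) (mulφ b))) ⟩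
  valInt ds (mulφ a ⊕ addDigit d (mulφ b))             ≡⟨ valInt-⊕ ds (mulφ a) (addDigit d (mulφ b)) ⟩
  mulφ^ (length ds) (mulφ a) ⊕ valInt (d ∷ ds) b       ≡⟨ cong (_⊕ valInt (d ∷ ds) b) (fold-init mulφ a (length ds)) ⟩
  mulφ^ (suc (length ds)) a ⊕ valInt (d ∷ ds) b        ∎

valInt-1∷ : ∀ ds → valInt (1 ∷ ds) 0φ ≡ φ^ (length ds) ⊕ valInt ds 0φ
valInt-1∷ ds = valInt-⊕ ds 1φ 0φ

valInt-zeros : ∀ k a → valInt (zeros k) a ≡ mulφ^ k a
valInt-zeros zero a = refl
valInt-zeros (suc k) a = begin
  valInt (zeros k) (addDigit 0 (mulφ a))   ≡⟨ valInt-zeros k (addDigit 0 (mulφ a)) ⟩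
  mulφ^ k (addDigit 0 (mulφ a))            ≡⟨ cong (mulφ^ k) (addDigit-0 (mulφ a)) ⟩
  mulφ^ k (mulφ a)                         ≡⟨ fold-init mulφ a k ⟩
  mulφ^ (suc k) a                          ∎

valInt-zeros++ : ∀ k xs → valInt (zeros k ++ xs) 0φ ≡ valInt xs 0φ
valInt-zeros++ zero xs = refl
valInt-zeros++ (suc k) xs = valInt-zeros++ k xs

valInt-as-valFrac : ∀ f a → valInt f a ≡ mulφ^ (length f) (a ⊕ valFrac f)
valInt-as-valFrac [] a = sym (⊕-identityʳ a)
valInt-as-valFrac (d ∷ f) a = begin
  valInt f (addDigit d (mulφ a))                      ≡⟨ valInt-as-valFrac f (addDigit d (mulφ a)) ⟩
  mulφ^ (length f) (addDigit d (mulφ a) ⊕ v)          ≡⟨ cong (mulφ^ (length f)) regroup ⟩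
  mulφ^ (length f) (mulφ (a ⊕ valFrac (d ∷ f)))       ≡⟨ fold-init mulφ (a ⊕ valFrac (d ∷ f)) (length f) ⟩
  mulφ^ (suc (length f)) (a ⊕ valFrac (d ∷ f))        ∎
  where
  v = valFrac f
  regroup : addDigit d (mulφ a) ⊕ v ≡ mulφ (a ⊕ divφ (addDigit d v))
  regroup = begin
    addDigit d (mulφ a) ⊕ v                       ≡⟨ addDigit-⊕ d (mulφ a) v ⟩
    addDigit d (mulφ a ⊕ v)                       ≡⟨ sym (⊕-addDigit d (mulφ a) v) ⟩
    mulφ a ⊕ addDigit d v                         ≡⟨ cong (mulφ a ⊕_) (sym (mulφ-divφ (addDigit d v))) ⟩
    mulφ a ⊕ mulφ (divφ (addDigit d v))           ≡⟨ sym (mulφ-⊕ a (divφ (addDigit d v))) ⟩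
    mulφ (a ⊕ divφ (addDigit d v))                ∎

valInt-digits : ∀ r → valInt (int r ++ frac r) 0φ ≡ mulφ^ (length (frac r)) (value r)
valInt-digits r = trans (valInt-++ (int r) (frac r) 0φ) (valInt-as-valFrac (frac r) _)

value-incrementUnits : ∀ xs d f →
  value ((xs ++ d ∷ 0 ∷ []) · f) ⊕ 1φ ≡ value ((xs ++ d ∷ 1 ∷ []) · f)
value-incrementUnits xs d f = begin
  valInt (xs ++ d ∷ 0 ∷ []) 0φ ⊕ F ⊕ 1φ   ≡⟨ cong (λ z → z ⊕ F ⊕ 1φ) (valInt-++ xs (d ∷ 0 ∷ []) 0φ) ⟩
  addDigit 0 u ⊕ F ⊕ 1φ                  ≡⟨ xy∙z≈xz∙y (addDigit 0 u) F 1φ ⟩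
  addDigit 0 u ⊕ 1φ ⊕ F                  ≡⟨ cong (λ z → z ⊕ 1φ ⊕ F) (addDigit-0 u) ⟩
  u ⊕ 1φ ⊕ F                             ≡⟨ cong (_⊕ F) (sym (addDigit-as-⊕ 1 u)) ⟩
  addDigit 1 u ⊕ F                       ≡⟨ cong (_⊕ F) (sym (valInt-++ xs (d ∷ 1 ∷ []) 0φ)) ⟩
  valInt (xs ++ d ∷ 1 ∷ []) 0φ ⊕ F       ∎
  where
  F = valFrac f
  u = mulφ (addDigit d (mulφ (valInt xs 0φ)))

-- Uniqueness of Bergman representations

fib : ℕ → ℕ
fib 0 = 0
fib 1 = 1
fib (suc (suc k)) = fib (suc k) + fib k

Bits : List ℕ → Set
Bits = All (_≤ 1)

zeck : List ℕ → ℕ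
zeck [] = 0
zeck (d ∷ ds) = d * fib (suc (suc (length ds))) + zeck ds

No11-tail : ∀ {x xs} → No11 (x ∷ xs) → No11 xs
No11-tail {xs = []} _ = tt
No11-tail {xs = _ ∷ _} (_ , n) = n

1*-+ : ∀ m n → 1 * m + n ≡ m + n
1*-+ m n = cong (_+ n) (ℕP.*-identityˡ m)

zeck<fib : ∀ {ds} → Bits ds → No11 ds → zeck ds < fib (suc (suc (length ds)))
zeck<fib [] _ = s≤s z≤n
zeck<fib (z≤n ∷ bs) n = ℕP.<-≤-trans (zeck<fib bs (No11-tail n)) (ℕP.m≤m+n _ _)
zeck<fib (s≤s z≤n ∷ []) _ = s≤s (s≤s z≤n)
zeck<fib {1 ∷ 0 ∷ ds} (s≤s z≤n ∷ z≤n ∷ bs) (_ , n) =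
  subst (_< fib (4 + length ds)) (sym (1*-+ _ (zeck ds)))
        (ℕP.+-monoʳ-< (fib (3 + length ds)) (zeck<fib bs (No11-tail n)))
zeck<fib (s≤s z≤n ∷ s≤s z≤n ∷ _) (n , _) = ⊥-elim (n (refl , refl))

fib≤zeck-1∷ : ∀ xs → fib (2 + length xs) ≤ zeck (1 ∷ xs)
fib≤zeck-1∷ xs = subst (fib (2 + length xs) ≤_) (sym (1*-+ _ (zeck xs))) (ℕP.m≤m+n _ (zeck xs))

zeck-0∷<1∷ : ∀ {xs ys} → length xs ≡ length ys → Bits ys → No11 ys → zeck (0 ∷ ys) < zeck (1 ∷ xs)
zeck-0∷<1∷ {xs} l bs n =
  ℕP.<-≤-trans (zeck<fib bs n) (subst (λ k → fib (2 + k) ≤ zeck (1 ∷ xs)) l (fib≤zeck-1∷ xs))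

zeck-injective : ∀ {xs ys} → length xs ≡ length ys → Bits xs → Bits ys → No11 xs → No11 ys →
                 zeck xs ≡ zeck ys → xs ≡ ys
zeck-injective _ [] [] _ _ _ = refl
zeck-injective () [] (_ ∷ _) _ _ _
zeck-injective () (_ ∷ _) [] _ _ _
zeck-injective l (z≤n ∷ bx) (z≤n ∷ by) nx ny eq =
  cong (0 ∷_) (zeck-injective (ℕP.suc-injective l) bx by (No11-tail nx) (No11-tail ny) eq)
zeck-injective {_ ∷ xs} {_ ∷ ys} l (s≤s z≤n ∷ bx) (s≤s z≤n ∷ by) nx ny eq =
  cong (1 ∷_) (zeck-injective l′ bx by (No11-tail nx) (No11-tail ny) (ℕP.+-cancelˡ-≡ _ _ _ eq′))
  where
  l′ = ℕP.suc-injective l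
  eq′ : fib (2 + length xs) + zeck xs ≡ fib (2 + length xs) + zeck ys
  eq′ = begin
    fib (2 + length xs) + zeck xs   ≡⟨ sym (1*-+ _ (zeck xs)) ⟩
    zeck (1 ∷ xs)                   ≡⟨ eq ⟩
    zeck (1 ∷ ys)                   ≡⟨ 1*-+ _ (zeck ys) ⟩
    fib (2 + length ys) + zeck ys   ≡⟨ cong (λ k → fib (2 + k) + zeck ys) (sym l′) ⟩
    fib (2 + length xs) + zeck ys   ∎
zeck-injective {_ ∷ xs} {_ ∷ ys} l (s≤s z≤n ∷ _) (z≤n ∷ by) _ ny eq =
  ⊥-elim (ℕP.<-irrefl (sym eq) (zeck-0∷<1∷ {xs} (ℕP.suc-injective l) by (No11-tail ny)))
zeck-injective {_ ∷ xs} {_ ∷ ys} l (z≤n ∷ bx) (s≤s z≤n ∷ _) nx _ eq =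
  ⊥-elim (ℕP.<-irrefl eq (zeck-0∷<1∷ {ys} (sym (ℕP.suc-injective l)) bx (No11-tail nx)))

zeckφ : ℤφ → ℤ
zeckφ (a , b) = a ℤ.+ (b ℤ.+ b)

zeckφ-⊕ : ∀ x y → zeckφ (x ⊕ y) ≡ zeckφ x ℤ.+ zeckφ y
zeckφ-⊕ (a , b) (c , d) = lemma a b c d
  where
  lemma : ∀ a b c d → (a ℤ.+ c) ℤ.+ ((b ℤ.+ d) ℤ.+ (b ℤ.+ d)) ≡ (a ℤ.+ (b ℤ.+ b)) ℤ.+ (c ℤ.+ (d ℤ.+ d))
  lemma = solve-∀

zeckφ-φ^ : ∀ k → zeckφ (φ^ k) ≡ + fib (suc (suc k))
zeckφ-φ^ 0 = refl
zeckφ-φ^ 1 = refl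
zeckφ-φ^ (suc (suc k)) = begin
  zeckφ (mulφ (mulφ (φ^ k)))                ≡⟨ cong zeckφ (mulφ² (φ^ k)) ⟩
  zeckφ (φ^ suc k ⊕ φ^ k)                   ≡⟨ zeckφ-⊕ (φ^ suc k) (φ^ k) ⟩
  zeckφ (φ^ suc k) ℤ.+ zeckφ (φ^ k)         ≡⟨ cong₂ ℤ._+_ (zeckφ-φ^ (suc k)) (zeckφ-φ^ k) ⟩
  + fib (suc (suc (suc (suc k))))           ∎

zeckφ-valInt : ∀ {ds} → Bits ds → zeckφ (valInt ds 0φ) ≡ + zeck ds
zeckφ-valInt [] = refl
zeckφ-valInt (z≤n ∷ bs) = zeckφ-valInt bs
zeckφ-valInt {1 ∷ ds} (s≤s z≤n ∷ bs) = begin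
  zeckφ (valInt (1 ∷ ds) 0φ)                      ≡⟨ cong zeckφ (valInt-1∷ ds) ⟩
  zeckφ (φ^ length ds ⊕ valInt ds 0φ)             ≡⟨ zeckφ-⊕ (φ^ length ds) (valInt ds 0φ) ⟩
  zeckφ (φ^ length ds) ℤ.+ zeckφ (valInt ds 0φ)   ≡⟨ cong₂ ℤ._+_ (zeckφ-φ^ (length ds)) (zeckφ-valInt bs) ⟩
  + (fib (2 + length ds) + zeck ds)               ≡⟨ cong +_ (sym (1*-+ _ (zeck ds))) ⟩
  + zeck (1 ∷ ds)                                 ∎

valInt-injective : ∀ {xs ys} → length xs ≡ length ys → Bits xs → Bits ys → No11 xs → No11 ys →
                   valInt xs 0φ ≡ valInt ys 0φ → xs ≡ ys
valInt-injective {xs} {ys} l bx by nx ny eq = zeck-injective l bx by nx ny (ℤP.+-injective (begin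
  + zeck xs              ≡⟨ sym (zeckφ-valInt bx) ⟩
  zeckφ (valInt xs 0φ)   ≡⟨ cong zeckφ eq ⟩
  zeckφ (valInt ys 0φ)   ≡⟨ zeckφ-valInt by ⟩
  + zeck ys              ∎))

No11-0∷ : ∀ {xs} → No11 xs → No11 (0 ∷ xs)
No11-0∷ {[]} _ = tt
No11-0∷ {_ ∷ _} n = (λ { (() , _) }) , n

No11-10∷ : ∀ {xs} → No11 xs → No11 (1 ∷ 0 ∷ xs)
No11-10∷ n = (λ { (_ , ()) }) , No11-0∷ n

No11-zeros++ : ∀ k {xs} → No11 xs → No11 (zeros k ++ xs)
No11-zeros++ zero n = n
No11-zeros++ (suc k) n = No11-0∷ (No11-zeros++ k n)

No11-∷zeros : ∀ {x} k → No11 (x ∷ zeros k)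
No11-∷zeros zero = tt
No11-∷zeros (suc k) = (λ { (_ , ()) }) , No11-∷zeros k

No11-++zeros : ∀ xs k → No11 xs → No11 (xs ++ zeros k)
No11-++zeros [] zero _ = tt
No11-++zeros [] (suc k) _ = No11-∷zeros k
No11-++zeros (_ ∷ []) k _ = No11-∷zeros k
No11-++zeros (_ ∷ y ∷ xs) k (h , n) = h , No11-++zeros (y ∷ xs) k n

No11-join : ∀ xs {x ys} → No11 (xs ++ x ∷ []) → No11 (x ∷ ys) → No11 (xs ++ x ∷ ys)
No11-join [] _ n = n
No11-join (_ ∷ []) (h , _) n = h , n
No11-join (_ ∷ y ∷ xs) (h , n₁) n = h , No11-join (y ∷ xs) n₁ n

bits-zeros : ∀ k → Bits (zeros k)
bits-zeros k = replicate⁺ k z≤n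

BergmanForm : Rep → Set
BergmanForm r = Digits01 r × No11 (int r ++ frac r)

-- aligned r s and aligned s r pad r and s to digit strings of equal length whose points are at the same position.
aligned : Rep → Rep → List ℕ
aligned r s = zeros (length (int s)) ++ (int r ++ frac r) ++ zeros (length (frac s))

length-zeros++ : ∀ k (xs : List ℕ) → length (zeros k ++ xs) ≡ k + length xs
length-zeros++ k xs = trans (length-++ (zeros k)) (cong (_+ length xs) (length-replicate k))

length-aligned : ∀ r s → length (aligned r s) ≡
  length (int s) + ((length (int r) + length (frac r)) + length (frac s))
length-aligned r s = begin
  length (aligned r s)                                            ≡⟨ length-zeros++ (length (int s)) _ ⟩
  length (int s) + length ((int r ++ frac r) ++ zeros k)          ≡⟨ cong (λ t → length (int s) + t) inner ⟩
  length (int s) + ((length (int r) + length (frac r)) + k)       ∎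
  where
  k = length (frac s)
  inner : length ((int r ++ frac r) ++ zeros k) ≡ (length (int r) + length (frac r)) + k
  inner = trans (length-++ (int r ++ frac r)) (cong₂ _+_ (length-++ (int r)) (length-replicate k))

aligned-length-comm : ∀ r s → length (aligned r s) ≡ length (aligned s r)
aligned-length-comm r s = trans (length-aligned r s) (trans (swap (length (int s)) (length (int r)) (length (frac r)) (length (frac s))) (sym (length-aligned s r)))
  where
  swap : ∀ a b c d → a + ((b + c) + d) ≡ b + ((a + d) + c)
  swap = ℕ-Solver.solve-∀

valInt-aligned : ∀ r s → valInt (aligned r s) 0φ ≡ mulφ^ (length (frac s)) (mulφ^ (length (frac r)) (value r))
valInt-aligned r s = begin
  valInt (zeros (length (int s)) ++ ds ++ zeros k) 0φ      ≡⟨ valInt-zeros++ (length (int s)) (ds ++ zeros k) ⟩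
  valInt (ds ++ zeros k) 0φ                 ≡⟨ valInt-++ ds (zeros k) 0φ ⟩
  valInt (zeros k) (valInt ds 0φ)           ≡⟨ valInt-zeros k (valInt ds 0φ) ⟩
  mulφ^ k (valInt ds 0φ)                    ≡⟨ cong (mulφ^ k) (valInt-digits r) ⟩
  mulφ^ k (mulφ^ (length (frac r)) (value r)) ∎
  where
  ds = int r ++ frac r
  k = length (frac s)

aligned-comm : ∀ {r s} → BergmanForm r → BergmanForm s → value r ≡ value s → aligned r s ≡ aligned s r
aligned-comm {r} {s} (br , nr) (bs , ns) v =
  valInt-injective (aligned-length-comm r s) (bits r s br) (bits s r bs) (no11 r s nr) (no11 s r ns) (begin
    valInt (aligned r s) 0φ                                          ≡⟨ valInt-aligned r s ⟩
    mulφ^ (length (frac s)) (mulφ^ (length (frac r)) (value r))      ≡⟨ cong (mulφ^ (length (frac s)) ∘ mulφ^ (length (frac r))) v ⟩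
    mulφ^ (length (frac s)) (mulφ^ (length (frac r)) (value s))      ≡⟨ mulφ^-comm (length (frac s)) (length (frac r)) (value s) ⟩
    mulφ^ (length (frac r)) (mulφ^ (length (frac s)) (value s))      ≡⟨ sym (valInt-aligned s r) ⟩
    valInt (aligned s r) 0φ                                          ∎)
  where
  bits : ∀ t u → Digits01 t → Bits (aligned t u)
  bits t u b = ++⁺ (bits-zeros (length (int u))) (++⁺ b (bits-zeros (length (frac u))))
  no11 : ∀ t u → No11 (int t ++ frac t) → No11 (aligned t u)
  no11 t u n = No11-zeros++ (length (int u)) (No11-++zeros (int t ++ frac t) (length (frac u)) n)

aligned-split : ∀ a x i f s → aligned ((a ++ x ∷ i) · f) s ≡
  (zeros (length (int s)) ++ a) ++ x ∷ ((i ++ f) ++ zeros (length (frac s)))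
aligned-split a x i f s = begin
  zs ++ ((a ++ x ∷ i) ++ f) ++ zeros k     ≡⟨ cong (λ t → zs ++ t ++ zeros k) (++-assoc a (x ∷ i) f) ⟩
  zs ++ (a ++ x ∷ (i ++ f)) ++ zeros k     ≡⟨ cong (zs ++_) (++-assoc a (x ∷ (i ++ f)) (zeros k)) ⟩
  zs ++ a ++ x ∷ ((i ++ f) ++ zeros k)     ≡⟨ sym (++-assoc zs a _) ⟩
  (zs ++ a) ++ x ∷ ((i ++ f) ++ zeros k)   ∎
  where
  zs = zeros (length (int s))
  k = length (frac s)

∷-aligned : ∀ {A : Set} (xs ys : List A) {x y : A} {u v} →
            length xs ≡ length ys → xs ++ x ∷ u ≡ ys ++ y ∷ v → x ≡ y
∷-aligned [] [] _ eq = ∷-injectiveˡ eq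
∷-aligned (_ ∷ xs) (_ ∷ ys) l eq = ∷-aligned xs ys (ℕP.suc-injective l) (∷-injectiveʳ eq)

digits-agree : ∀ {r s a b x y} {i j : List ℕ} → BergmanForm r → BergmanForm s → value r ≡ value s →
               int r ≡ a ++ x ∷ i → int s ≡ b ++ y ∷ j → length i ≡ length j → x ≡ y
digits-agree {_ · f} {_ · g} {a} {b} {x} {y} {i} {j} br bs v refl refl l =
  ∷-aligned (zeros (length (b ++ y ∷ j)) ++ a) (zeros (length (a ++ x ∷ i)) ++ b) prefix-length
    (begin
      (zeros (length (b ++ y ∷ j)) ++ a) ++ x ∷ ((i ++ f) ++ zeros (length g))
        ≡⟨ sym (aligned-split a x i f ((b ++ y ∷ j) · g)) ⟩
      aligned ((a ++ x ∷ i) · f) ((b ++ y ∷ j) · g)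
        ≡⟨ aligned-comm {(a ++ x ∷ i) · f} {(b ++ y ∷ j) · g} br bs v ⟩
      aligned ((b ++ y ∷ j) · g) ((a ++ x ∷ i) · f)
        ≡⟨ aligned-split b y j g ((a ++ x ∷ i) · f) ⟩
      (zeros (length (a ++ x ∷ i)) ++ b) ++ y ∷ ((j ++ g) ++ zeros (length f))
        ∎)
  where
  swap : ∀ p q n → (q + suc n) + p ≡ (p + suc n) + q
  swap = ℕ-Solver.solve-∀
  prefix-length : length (zeros (length (b ++ y ∷ j)) ++ a) ≡ length (zeros (length (a ++ x ∷ i)) ++ b)
  prefix-length = begin
    length (zeros (length (b ++ y ∷ j)) ++ a)                       ≡⟨ length-zeros++ (length (b ++ y ∷ j)) a ⟩
    length (b ++ y ∷ j) + length a                 ≡⟨ cong (_+ length a) (length-++ b) ⟩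
    (length b + suc (length j)) + length a         ≡⟨ cong (λ n → (length b + suc n) + length a) (sym l) ⟩
    (length b + suc (length i)) + length a         ≡⟨ swap (length a) (length b) (length i) ⟩
    (length a + suc (length i)) + length b         ≡⟨ cong (_+ length b) (sym (length-++ a)) ⟩
    length (a ++ x ∷ i) + length b                 ≡⟨ sym (length-zeros++ (length (a ++ x ∷ i)) b) ⟩
    length (zeros (length (a ++ x ∷ i)) ++ b)                       ∎

lowerUnits-bergmanForm : ∀ p f → Digits01 ((p ++ 1 ∷ 1 ∷ []) · f) → No11 (p ++ 1 ∷ []) → No11 (1 ∷ f) →
                         BergmanForm ((p ++ 1 ∷ 0 ∷ []) · f)
lowerUnits-bergmanForm p f bits np nf =
  ++⁺ (++⁺ (++⁻ˡ p (++⁻ˡ (p ++ 1 ∷ 1 ∷ []) bits)) (s≤s z≤n ∷ z≤n ∷ [])) (++⁻ʳ (p ++ 1 ∷ 1 ∷ []) bits) ,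
  subst No11 (sym (++-assoc p (1 ∷ 0 ∷ []) f)) (No11-join p np (No11-10∷ (No11-tail nf)))

no-canonical : ∀ {N s b y} → BergmanForm s → int s ≡ b ++ 0 ∷ y ∷ [] → value s ⊕ 1φ ≡ embed N →
               ¬ Σ Rep (IsCanonicalRep N)
no-canonical {s = s} {b} {y} bs eq vs ((_ · f) , bits , (p , refl , np , nf) , v) =
  ℕP.1+n≢0 (digits-agree {a = p} {b} {i = 0 ∷ []} {y ∷ []}
                         (lowerUnits-bergmanForm p f bits np nf) bs lowered refl eq refl)
  where
  lowered : value ((p ++ 1 ∷ 0 ∷ []) · f) ≡ value s
  lowered = ⊕-cancelʳ 1φ (trans (value-incrementUnits p 1 f) (trans v (sym vs)))

-- The representations of L_n and L_n + 1

w10 w01 : List ℕ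
w10 = 1 ∷ 0 ∷ []
w01 = 0 ∷ 1 ∷ []

bits-pow : ∀ n {w} → Bits w → Bits (pow n w)
bits-pow n b = concat⁺ (replicate⁺ n b)

bits-10 : Bits w10
bits-10 = s≤s z≤n ∷ z≤n ∷ []

bits-01 : Bits w01
bits-01 = z≤n ∷ s≤s z≤n ∷ []

pow-suc : ∀ n (w : List ℕ) → pow (suc n) w ≡ pow n w ++ w
pow-suc zero w = ++-identityʳ w
pow-suc (suc n) w = trans (cong (w ++_) (pow-suc n w)) (sym (++-assoc w (pow n w) w))

length-pow₂ : ∀ n {a b : ℕ} → length (pow n (a ∷ b ∷ [])) ≡ 2 * n
length-pow₂ zero = refl
length-pow₂ (suc n) = trans (cong (suc ∘ suc) (length-pow₂ n)) (sym (2*suc n))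

suc-length-pow₂ : ∀ n {a b : ℕ} → suc (length (pow n (a ∷ b ∷ []))) ≡ 2 * n + 1
suc-length-pow₂ n = trans (cong suc (length-pow₂ n)) (ℕP.+-comm 1 (2 * n))

zeros-+2 : ∀ k → zeros (suc (suc k)) ≡ zeros k ++ 0 ∷ 0 ∷ []
zeros-+2 zero = refl
zeros-+2 (suc k) = cong (0 ∷_) (zeros-+2 k)

No11-[10]ⁿ++ : ∀ n {xs} → No11 xs → No11 (pow n w10 ++ xs)
No11-[10]ⁿ++ zero n = n
No11-[10]ⁿ++ (suc k) n = No11-10∷ (No11-[10]ⁿ++ k n)

No11-1[01]ⁿ++ : ∀ n {xs} → No11 (1 ∷ xs) → No11 (1 ∷ pow n w01 ++ xs)
No11-1[01]ⁿ++ zero n = n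
No11-1[01]ⁿ++ (suc k) n = No11-10∷ (No11-1[01]ⁿ++ k n)

No11-1[01]ⁿ : ∀ n → No11 (1 ∷ pow n w01)
No11-1[01]ⁿ n = subst (No11 ∘ (1 ∷_)) (++-identityʳ (pow n w01)) (No11-1[01]ⁿ++ n {[]} tt)

1[01]ⁿ⁺¹ : ∀ n → 1 ∷ pow (suc n) w01 ≡ (1 ∷ pow n w01) ++ 0 ∷ 1 ∷ []
1[01]ⁿ⁺¹ n = cong (1 ∷_) (pow-suc n w01)

valInt-1∷zeros : ∀ k → valInt (1 ∷ zeros k) 0φ ≡ φ^ k
valInt-1∷zeros k = valInt-zeros k 1φ

valInt-1∷zeros∷1 : ∀ k → valInt (1 ∷ zeros k ++ 1 ∷ []) 0φ ≡ φ^ (suc k) ⊕ 1φ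
valInt-1∷zeros∷1 k = begin
  valInt (1 ∷ zeros k ++ 1 ∷ []) 0φ             ≡⟨ valInt-++ (1 ∷ zeros k) (1 ∷ []) 0φ ⟩
  addDigit 1 (mulφ (valInt (1 ∷ zeros k) 0φ))   ≡⟨ cong (addDigit 1 ∘ mulφ) (valInt-1∷zeros k) ⟩
  addDigit 1 (φ^ suc k)                         ≡⟨ addDigit-as-⊕ 1 (φ^ suc k) ⟩
  φ^ suc k ⊕ 1φ                                 ∎

valFrac-zeros∷1 : ∀ k → valFrac (zeros k ++ 1 ∷ []) ≡ φ⁻^ (suc k)
valFrac-zeros∷1 zero = refl
valFrac-zeros∷1 (suc k) = cong divφ (trans (addDigit-0 _) (valFrac-zeros∷1 k))

2*suc∸1 : ∀ m → 2 * suc m ∸ 1 ≡ suc (2 * m)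
2*suc∸1 m = cong (_∸ 1) (2*suc m)

valFrac-evenTail : ∀ m → valFrac (zeros (2 * suc m ∸ 1) ++ 1 ∷ []) ≡ φ⁻^ (2 * suc m)
valFrac-evenTail m = trans (valFrac-zeros∷1 (2 * suc m ∸ 1)) (cong φ⁻^_ (ℕP.suc-pred (2 * suc m)))

valInt-[10]ᵐ11 : ∀ m → valInt (pow m w10 ++ 1 ∷ 1 ∷ []) 0φ ≡ φ^ (length (pow m w10 ++ 1 ∷ 1 ∷ []))
valInt-[10]ᵐ11 zero = refl
valInt-[10]ᵐ11 (suc m) = begin
  valInt (1 ∷ 0 ∷ ds) 0φ               ≡⟨ valInt-1∷ (0 ∷ ds) ⟩
  φ^ suc (length ds) ⊕ valInt ds 0φ     ≡⟨ cong (φ^ suc (length ds) ⊕_) (valInt-[10]ᵐ11 m) ⟩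
  φ^ suc (length ds) ⊕ φ^ length ds     ≡⟨ sym (mulφ² (φ^ length ds)) ⟩
  φ^ suc (suc (length ds))              ∎
  where ds = pow m w10 ++ 1 ∷ 1 ∷ []

length-[10]ᵐ11 : ∀ m → length (pow m w10 ++ 1 ∷ 1 ∷ []) ≡ 2 * suc m
length-[10]ᵐ11 zero = refl
length-[10]ᵐ11 (suc m) = trans (cong (suc ∘ suc) (length-[10]ᵐ11 m)) (sym (2*suc (suc m)))

valInt-1[01]ⁿ : ∀ n → valInt (1 ∷ pow n w01) 0φ ⊕ φ⁻^ 1 ≡ φ^ suc (length (pow n w01))
valInt-1[01]ⁿ zero = refl
valInt-1[01]ⁿ (suc n) = begin
  valInt (1 ∷ 0 ∷ 1 ∷ ds) 0φ ⊕ φ⁻^ 1                        ≡⟨ cong (_⊕ φ⁻^ 1) (valInt-1∷ (0 ∷ 1 ∷ ds)) ⟩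
  φ^ suc (suc L) ⊕ valInt (1 ∷ ds) 0φ ⊕ φ⁻^ 1               ≡⟨ ⊕-assoc (φ^ suc (suc L)) _ (φ⁻^ 1) ⟩
  φ^ suc (suc L) ⊕ (valInt (1 ∷ ds) 0φ ⊕ φ⁻^ 1)             ≡⟨ cong (φ^ suc (suc L) ⊕_) (valInt-1[01]ⁿ n) ⟩
  φ^ suc (suc L) ⊕ φ^ suc L                                 ≡⟨ sym (mulφ² (φ^ suc L)) ⟩
  φ^ suc (suc (suc L))                                      ∎
  where
  ds = pow n w01
  L = length ds

divφ²-⊕ : ∀ x y → divφ (divφ x) ⊕ divφ (divφ y) ≡ divφ (divφ (x ⊕ y))
divφ²-⊕ x y = sym (trans (cong divφ (divφ-⊕ x y)) (divφ-⊕ (divφ x) (divφ y)))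

valFrac-[01]ⁿ : ∀ n → valFrac (pow n w01) ⊕ φ⁻^ suc (length (pow n w01)) ≡ φ⁻^ 1
valFrac-[01]ⁿ zero = refl
valFrac-[01]ⁿ (suc n) = begin
  divφ (addDigit 0 (divφ (addDigit 1 V))) ⊕ divφ (divφ X)   ≡⟨ cong (λ z → divφ z ⊕ divφ (divφ X)) (addDigit-0 (divφ (addDigit 1 V))) ⟩
  divφ (divφ (addDigit 1 V)) ⊕ divφ (divφ X)                ≡⟨ divφ²-⊕ (addDigit 1 V) X ⟩
  divφ (divφ (addDigit 1 V ⊕ X))                            ≡⟨ cong (divφ ∘ divφ) (addDigit-⊕ 1 V X) ⟩
  divφ (divφ (addDigit 1 (V ⊕ X)))                          ≡⟨ cong (divφ ∘ divφ ∘ addDigit 1) (valFrac-[01]ⁿ n) ⟩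
  divφ (divφ (addDigit 1 (φ⁻^ 1)))                          ∎
  where
  V = valFrac (pow n w01)
  X = φ⁻^ suc (length (pow n w01))

valFrac-[10]ⁿ01 : ∀ n → valFrac (pow n w10 ++ w01) ⊕ φ⁻^ suc (length (pow n w10)) ≡ 1φ
valFrac-[10]ⁿ01 zero = refl
valFrac-[10]ⁿ01 (suc n) = begin
  divφ (addDigit 1 (divφ (addDigit 0 V))) ⊕ divφ (divφ X)   ≡⟨ cong (λ z → divφ (addDigit 1 (divφ z)) ⊕ divφ (divφ X)) (addDigit-0 V) ⟩
  divφ (addDigit 1 (divφ V)) ⊕ divφ (divφ X)                ≡⟨ sym (divφ-⊕ (addDigit 1 (divφ V)) (divφ X)) ⟩
  divφ (addDigit 1 (divφ V) ⊕ divφ X)                       ≡⟨ cong divφ (addDigit-⊕ 1 (divφ V) (divφ X)) ⟩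
  divφ (addDigit 1 (divφ V ⊕ divφ X))                       ≡⟨ cong (divφ ∘ addDigit 1) (sym (divφ-⊕ V X)) ⟩
  divφ (addDigit 1 (divφ (V ⊕ X)))                          ≡⟨ cong (divφ ∘ addDigit 1 ∘ divφ) (valFrac-[10]ⁿ01 n) ⟩
  divφ (addDigit 1 (divφ 1φ))                               ∎
  where
  V = valFrac (pow n w10 ++ w01)
  X = φ⁻^ suc (length (pow n w10))

β-L₂ₙ : ∀ m → IsBergman (lucas (2 * suc m)) ((1 ∷ zeros (2 * suc m)) · (zeros (2 * suc m ∸ 1) ++ 1 ∷ []))
β-L₂ₙ m =
  s≤s z≤n ∷ ++⁺ (bits-zeros (2 * suc m)) (++⁺ (bits-zeros (2 * suc m ∸ 1)) (s≤s z≤n ∷ [])) ,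
  No11-10∷ (No11-zeros++ (2 * suc m ∸ 1) (No11-zeros++ (2 * suc m ∸ 1) tt)) ,
  (begin
    valInt (1 ∷ zeros (2 * suc m)) 0φ ⊕ valFrac (zeros (2 * suc m ∸ 1) ++ 1 ∷ [])
      ≡⟨ cong₂ _⊕_ (valInt-1∷zeros (2 * suc m)) (valFrac-evenTail m) ⟩
    φ^ (2 * suc m) ⊕ φ⁻^ (2 * suc m)
      ≡⟨ sym (lucas-even (suc m)) ⟩
    embed (lucas (2 * suc m)) ∎)

γ-L₂ₙ : ∀ m → IsCanonicalRep (lucas (2 * suc m))
                ((pow m w10 ++ 1 ∷ 1 ∷ []) · (zeros (2 * suc m ∸ 1) ++ 1 ∷ []))
γ-L₂ₙ m =
  ++⁺ (++⁺ (bits-pow m bits-10) (s≤s z≤n ∷ s≤s z≤n ∷ [])) (++⁺ (bits-zeros (2 * suc m ∸ 1)) (s≤s z≤n ∷ [])) ,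
  (pow m w10 , refl , No11-[10]ⁿ++ m tt ,
   subst (λ j → No11 (1 ∷ zeros j ++ 1 ∷ [])) (sym (2*suc∸1 m)) (No11-10∷ (No11-zeros++ (2 * m) tt))) ,
  (begin
    valInt (pow m w10 ++ 1 ∷ 1 ∷ []) 0φ ⊕ valFrac (zeros (2 * suc m ∸ 1) ++ 1 ∷ [])
      ≡⟨ cong₂ _⊕_ (valInt-[10]ᵐ11 m) (valFrac-evenTail m) ⟩
    φ^ length (pow m w10 ++ 1 ∷ 1 ∷ []) ⊕ φ⁻^ (2 * suc m)
      ≡⟨ cong (λ k → φ^ k ⊕ φ⁻^ (2 * suc m)) (length-[10]ᵐ11 m) ⟩
    φ^ (2 * suc m) ⊕ φ⁻^ (2 * suc m)
      ≡⟨ sym (lucas-even (suc m)) ⟩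
    embed (lucas (2 * suc m)) ∎)

β-L₂ₙ₊₁ : ∀ n → IsBergman (lucas (2 * n + 1)) ((1 ∷ pow n w01) · pow n w01)
β-L₂ₙ₊₁ n =
  s≤s z≤n ∷ ++⁺ (bits-pow n bits-01) (bits-pow n bits-01) ,
  No11-1[01]ⁿ++ n (No11-1[01]ⁿ n) ,
  ⊕-cancelʳ (φ⁻^ k) (begin
    U ⊕ T ⊕ φ⁻^ k                    ≡⟨ cong (λ j → U ⊕ T ⊕ φ⁻^ j) (sym (suc-length-pow₂ n)) ⟩
    U ⊕ T ⊕ φ⁻^ suc L                ≡⟨ ⊕-assoc U T (φ⁻^ suc L) ⟩
    U ⊕ (T ⊕ φ⁻^ suc L)              ≡⟨ cong (U ⊕_) (valFrac-[01]ⁿ n) ⟩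
    U ⊕ φ⁻^ 1                        ≡⟨ valInt-1[01]ⁿ n ⟩
    φ^ suc L                         ≡⟨ cong φ^_ (suc-length-pow₂ n) ⟩
    φ^ k                             ≡⟨ sym (lucas-odd n) ⟩
    embed (lucas k) ⊕ φ⁻^ k          ∎)
  where
  k = 2 * n + 1
  L = length (pow n w01)
  U = valInt (1 ∷ pow n w01) 0φ
  T = valFrac (pow n w01)

β-L₂ₙ+1 : ∀ m → IsBergman (lucas (2 * suc m) + 1)
                  ((1 ∷ zeros (2 * suc m ∸ 1) ++ 1 ∷ []) · (zeros (2 * suc m ∸ 1) ++ 1 ∷ []))
β-L₂ₙ+1 m =
  ++⁺ (s≤s z≤n ∷ ++⁺ (bits-zeros j) (s≤s z≤n ∷ [])) (++⁺ (bits-zeros j) (s≤s z≤n ∷ [])) ,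
  subst (λ j → No11 ((1 ∷ zeros j ++ 1 ∷ []) ++ zeros j ++ 1 ∷ [])) (sym (2*suc∸1 m))
        (No11-10∷ (subst No11 (sym (++-assoc (zeros (2 * m)) (1 ∷ []) (zeros (suc (2 * m)) ++ 1 ∷ [])))
                             (No11-zeros++ (2 * m) (No11-10∷ (No11-zeros++ (2 * m) tt))))) ,
  (begin
    valInt (1 ∷ zeros j ++ 1 ∷ []) 0φ ⊕ valFrac tail    ≡⟨ cong₂ _⊕_ (valInt-1∷zeros∷1 j) (valFrac-evenTail m) ⟩
    φ^ suc j ⊕ 1φ ⊕ φ⁻^ (2 * suc m)                    ≡⟨ cong (λ k → φ^ k ⊕ 1φ ⊕ φ⁻^ (2 * suc m)) (ℕP.suc-pred (2 * suc m)) ⟩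
    φ^ (2 * suc m) ⊕ 1φ ⊕ φ⁻^ (2 * suc m)              ≡⟨ xy∙z≈xz∙y (φ^ (2 * suc m)) 1φ (φ⁻^ (2 * suc m)) ⟩
    φ^ (2 * suc m) ⊕ φ⁻^ (2 * suc m) ⊕ 1φ              ≡⟨ cong (_⊕ 1φ) (sym (lucas-even (suc m))) ⟩
    embed (lucas (2 * suc m)) ⊕ 1φ                     ∎)
  where
  j = 2 * suc m ∸ 1
  tail = zeros j ++ 1 ∷ []

β-L₂ₙ₊₁+1 : ∀ n → IsBergman (lucas (2 * n + 1) + 1) ((1 ∷ zeros (2 * n + 1)) · (pow n w10 ++ w01))
β-L₂ₙ₊₁+1 n =
  s≤s z≤n ∷ ++⁺ (bits-zeros k) (++⁺ (bits-pow n bits-10) bits-01) ,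
  subst (λ j → No11 (1 ∷ zeros j ++ pow n w10 ++ w01)) (ℕP.+-comm 1 (2 * n))
        (No11-10∷ (No11-zeros++ (2 * n) (No11-[10]ⁿ++ n (No11-0∷ {1 ∷ []} tt)))) ,
  ⊕-cancelʳ (φ⁻^ k) (begin
    valInt (1 ∷ zeros k) 0φ ⊕ V ⊕ φ⁻^ k     ≡⟨ cong (λ z → z ⊕ V ⊕ φ⁻^ k) (valInt-1∷zeros k) ⟩
    φ^ k ⊕ V ⊕ φ⁻^ k                         ≡⟨ ⊕-assoc (φ^ k) V (φ⁻^ k) ⟩
    φ^ k ⊕ (V ⊕ φ⁻^ k)                       ≡⟨ cong (λ j → φ^ k ⊕ (V ⊕ φ⁻^ j)) (sym (suc-length-pow₂ n)) ⟩
    φ^ k ⊕ (V ⊕ φ⁻^ suc (length (pow n w10)))  ≡⟨ cong (φ^ k ⊕_) (valFrac-[10]ⁿ01 n) ⟩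
    φ^ k ⊕ 1φ                                ≡⟨ cong (_⊕ 1φ) (sym (lucas-odd n)) ⟩
    embed (lucas k) ⊕ φ⁻^ k ⊕ 1φ            ≡⟨ xy∙z≈xz∙y (embed (lucas k)) (φ⁻^ k) 1φ ⟩
    embed (lucas k) ⊕ 1φ ⊕ φ⁻^ k            ∎)
  where
  k = 2 * n + 1
  V = valFrac (pow n w10 ++ w01)

-- The witness is β(L_{2n+1} − 1) = 1[01]^{n−1}00·[01]^n.
noCanonical-L₂ₙ₊₁ : ∀ m → ¬ Σ Rep (IsCanonicalRep (lucas (2 * suc m + 1)))
noCanonical-L₂ₙ₊₁ m = no-canonical {b = 1 ∷ pow m w01}
  ( ++⁺ (++⁺ (s≤s z≤n ∷ bits-pow m bits-01) (z≤n ∷ z≤n ∷ [])) (bits-pow (suc m) bits-01)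
  , subst No11 (sym (++-assoc (1 ∷ pow m w01) (0 ∷ 0 ∷ []) (pow (suc m) w01)))
          (No11-1[01]ⁿ++ m (No11-10∷ (No11-0∷ (No11-0∷ (No11-1[01]ⁿ m))))))
  refl
  (begin
    value (((1 ∷ pow m w01) ++ 0 ∷ 0 ∷ []) · f) ⊕ 1φ   ≡⟨ value-incrementUnits (1 ∷ pow m w01) 0 f ⟩
    value (((1 ∷ pow m w01) ++ 0 ∷ 1 ∷ []) · f)        ≡⟨ cong (λ i → value (i · f)) (sym (1[01]ⁿ⁺¹ m)) ⟩
    value ((1 ∷ pow (suc m) w01) · f)                  ≡⟨ proj₂ (proj₂ (β-L₂ₙ₊₁ (suc m))) ⟩
    embed (lucas (2 * suc m + 1))                      ∎)
  where f = pow (suc m) w01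

noCanonical-L₂ₙ+1 : ∀ m → ¬ Σ Rep (IsCanonicalRep (lucas (2 * suc m) + 1))
noCanonical-L₂ₙ+1 m with β-L₂ₙ m
... | bits , no11 , v = no-canonical {b = 1 ∷ zeros (2 * m)} (bits , no11)
  (trans (cong (λ k → 1 ∷ zeros k) (2*suc m)) (cong (1 ∷_) (zeros-+2 (2 * m))))
  (cong (_⊕ 1φ) v)

noCanonical-L₂ₙ₊₁+1 : ∀ m → ¬ Σ Rep (IsCanonicalRep (lucas (2 * suc m + 1) + 1))
noCanonical-L₂ₙ₊₁+1 m with β-L₂ₙ₊₁ (suc m)
... | bits , no11 , v = no-canonical {b = 1 ∷ pow m w01} (bits , no11) (1[01]ⁿ⁺¹ m) (cong (_⊕ 1φ) v)

lemma4 : (n : ℕ) → 1 ≤ n →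
    IsBergman (lucas (2 * n)) ((1 ∷ zeros (2 * n)) · (zeros (2 * n ∸ 1) ++ (1 ∷ [])))
    × IsGamma (lucas (2 * n)) ((pow (n ∸ 1) (1 ∷ 0 ∷ []) ++ (1 ∷ 1 ∷ [])) · (zeros (2 * n ∸ 1) ++ (1 ∷ [])))
    × IsBergman (lucas (2 * n + 1)) ((1 ∷ pow n (0 ∷ 1 ∷ [])) · pow n (0 ∷ 1 ∷ []))
    × IsGamma (lucas (2 * n + 1)) ((1 ∷ pow n (0 ∷ 1 ∷ [])) · pow n (0 ∷ 1 ∷ []))
    × IsBergman (lucas (2 * n) + 1) ((1 ∷ zeros (2 * n ∸ 1) ++ (1 ∷ [])) · (zeros (2 * n ∸ 1) ++ (1 ∷ [])))
    × IsGamma (lucas (2 * n) + 1) ((1 ∷ zeros (2 * n ∸ 1) ++ (1 ∷ [])) · (zeros (2 * n ∸ 1) ++ (1 ∷ [])))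
    × IsBergman (lucas (2 * n + 1) + 1) ((1 ∷ zeros (2 * n + 1)) · (pow n (1 ∷ 0 ∷ []) ++ (0 ∷ 1 ∷ [])))
    × IsGamma (lucas (2 * n + 1) + 1) ((1 ∷ zeros (2 * n + 1)) · (pow n (1 ∷ 0 ∷ []) ++ (0 ∷ 1 ∷ [])))
lemma4 (suc m) _ =
    β-L₂ₙ m
  , inj₁ (γ-L₂ₙ m)
  , β-L₂ₙ₊₁ (suc m)
  , inj₂ (noCanonical-L₂ₙ₊₁ m , β-L₂ₙ₊₁ (suc m))
  , β-L₂ₙ+1 m
  , inj₂ (noCanonical-L₂ₙ+1 m , β-L₂ₙ+1 m)
  , β-L₂ₙ₊₁+1 (suc m)
  , inj₂ (noCanonical-L₂ₙ₊₁+1 m , β-L₂ₙ₊₁+1 (suc m))
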